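{- Let $G$ be a plane graph with even polygonal faces. Let $\chi_f(G)$ be the maximum integer $k$ such that $G$ admits a half-monochromatic $k$-coloring, and let $\alpha(G)$ be the independence number of $G$. Then $\chi_f(G) \le \frac{3}{2}\alpha(G)$.
   Context: All colorings are proper: adjacent vertices receive distinct colors. A $k$-coloring uses exactly $k$ colors. A plane graph $G$ is a plane graph with even polygonal faces if every face of $G$ is bounded by a cycle of even length. A (proper) coloring of such a $G$ is half-monochromatic if, for every face $f$ of $G$, half of the vertices incident with $f$ receive the same color (i.e., if the boundary of $f$ has $2n$ vertices, some $n$ of them share one color). $\alpha(G)$ is the maximum size of an independent set of vertices of $G$. -}

module Defs where

open import Data.Nat using (ℕ; zero; suc; _+_; _*_; _≤_)
open import Data.Fin using (Fin) renaming (_≟_ to _≟ᶠ_)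
open import Data.Fin.Subset using (Subset; _∈_; _∉_; ∣_∣)
open import Data.List using (List; length; filter; allFin)
open import Data.Product using (Σ; ∃; _×_; _,_)
open import Relation.Nullary using (¬_)
open import Relation.Nullary.Decidable using (_×-dec_)
open import Relation.Binary.PropositionalEquality using (_≡_; _≢_)

iter : {A : Set} → (A → A) → ℕ → A → A
iter f zero    x = x
iter f (suc k) x = f (iter f k x)

-- Plane graphs, represented combinatorially as rotation systems
-- (combinatorial maps) of genus 0.
--
-- Vertices are Fin nV, darts (= half-edges, oriented edges) are Fin nD.
-- A dart x goes from  tail x  to  tail (rev x).  rot x is the next dart
-- around the vertex  tail x  in the (counterclockwise) rotation.  The face
-- permutation is  φ = rot ∘ rev : after traversing x (ending at the head of
-- x) we turn to the next dart around the head.  Faces are the φ-orbits,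
-- given explicitly by a surjection  face : Fin nD → Fin nF  whose fibres
-- are exactly the φ-orbits.  Genus 0 is Euler's formula V - E + F = 2
-- (with E = nD / 2), for a connected map.

record RotationSystem : Set where
  field
    nV nD nF : ℕ
    tail     : Fin nD → Fin nV
    rev      : Fin nD → Fin nD
    rot      : Fin nD → Fin nD
    rot⁻¹    : Fin nD → Fin nD
    face     : Fin nD → Fin nF

  φ : Fin nD → Fin nD
  φ x = rot (rev x)

  Adj : Fin nV → Fin nV → Set
  Adj u v = Σ (Fin nD) λ x → (tail x ≡ u) × (tail (rev x) ≡ v)

  faceLength : Fin nF → ℕ
  faceLength f = length (filter (λ x → face x ≟ᶠ f) (allFin nD))

open RotationSystem public

data Reachable (G : RotationSystem) : Fin (nV G) → Fin (nV G) → Set where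
  here : ∀ {u} → Reachable G u u
  step : ∀ {u} x → Reachable G (tail G (rev G x)) u → Reachable G (tail G x) u

record IsPlaneSimpleGraph (G : RotationSystem) : Set where
  field
    rev-invol   : ∀ x → (rev G) ((rev G) x) ≡ x
    rev-nofix   : ∀ x → (rev G) x ≢ x
    rot-inv₁    : ∀ x → (rot G) ((rot⁻¹ G) x) ≡ x
    rot-inv₂    : ∀ x → (rot⁻¹ G) ((rot G) x) ≡ x
    rot-tail    : ∀ x → (tail G) ((rot G) x) ≡ (tail G) x
    rot-trans   : ∀ x y → (tail G) x ≡ (tail G) y → ∃ λ k → iter (rot G) k x ≡ y
    face-surj   : ∀ f → ∃ λ x → (face G) x ≡ f
    face-orbit₁ : ∀ x y → (face G) x ≡ (face G) y → ∃ λ k → iter (φ G) k x ≡ y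
    face-orbit₂ : ∀ x k → (face G) (iter (φ G) k x) ≡ (face G) x
    no-loop     : ∀ x → (tail G) ((rev G) x) ≢ (tail G) x
    no-multi    : ∀ x y → (tail G) x ≡ (tail G) y → (tail G) ((rev G) x) ≡ (tail G) ((rev G) y) → x ≡ y
    connected   : ∀ u v → Reachable G u v
    -- genus 0 (Euler's formula  V - E + F = 2,  E = nD/2)
    euler       : 2 * ((nV G) + (nF G)) ≡ (nD G) + 4

open IsPlaneSimpleGraph public

-- every face is bounded by a cycle of even length: the boundary walk of the
-- face visits pairwise distinct vertices, has length ≥ 3, and is even
EvenPolygonalFaces : RotationSystem → Set
EvenPolygonalFaces G =
  (∀ x y → face G x ≡ face G y → tail G x ≡ tail G y → x ≡ y) ×
  (∀ f → 3 ≤ faceLength G f) ×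
  (∀ f → ∃ λ m → faceLength G f ≡ 2 * m)

record PlaneGraphEvenFaces : Set where
  field
    graph : RotationSystem
    plane : IsPlaneSimpleGraph graph
    even  : EvenPolygonalFaces graph

record KColoring (G : RotationSystem) (k : ℕ) : Set where
  field
    col    : Fin (nV G) → Fin k
    proper : ∀ u v → Adj G u v → col u ≢ col v
    onto   : ∀ j → ∃ λ u → col u ≡ j

colorCountOnFace : (G : RotationSystem) {k : ℕ} → (Fin (nV G) → Fin k) →
                   Fin (nF G) → Fin k → ℕ
colorCountOnFace G c f j =
  length (filter (λ x → (face G x ≟ᶠ f) ×-dec (c (tail G x) ≟ᶠ j)) (allFin (nD G)))

HalfMonochromatic : (G : RotationSystem) {k : ℕ} → KColoring G k → Set
HalfMonochromatic G {k} c =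
  ∀ f → ∃ λ (j : Fin k) → 2 * colorCountOnFace G (KColoring.col c) f j ≡ faceLength G f

AdmitsHalfMono : RotationSystem → ℕ → Set
AdmitsHalfMono G k = Σ (KColoring G k) λ c → HalfMonochromatic G c

IsChiF : RotationSystem → ℕ → Set
IsChiF G k = AdmitsHalfMono G k × (∀ k' → AdmitsHalfMono G k' → k' ≤ k)

Independent : (G : RotationSystem) → Subset (nV G) → Set
Independent G S = ∀ u v → Adj G u v → u ∈ S → v ∉ S

IsIndependenceNumber : RotationSystem → ℕ → Set
IsIndependenceNumber G a =
  (Σ (Subset (nV G)) λ S → Independent G S × ∣ S ∣ ≡ a) ×
  (∀ S → Independent G S → ∣ S ∣ ≤ a)

{-# OPTIONS --safe #-}
module Submission where

open import Defs
  using ( RotationSystem; IsPlaneSimpleGraph; Reachable; here; step; iter; PlaneGraphEvenFaces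
        ; KColoring; HalfMonochromatic; colorCountOnFace; IsChiF; Independent; IsIndependenceNumber)
open import Level using (Level; 0ℓ)
open import Data.Bool using (Bool; true; false)
import Data.Bool.Properties as Bool
open import Data.Empty using (⊥; ⊥-elim)
open import Data.Fin using (Fin; zero; suc; _≟_)
open import Data.Fin.Properties as Fin using (0≢1+n; any?; all?; ¬∀⟶∃¬)
open import Data.Fin.Subset using (Subset; ∣_∣) renaming (_∈_ to _∈ₛ_)
open import Data.List using (List; length; filter; tabulate; allFin)
open import Data.List.Extrema.Nat using (argmax; argmax-all; f[xs]≤f[argmax])
open import Data.List.Membership.Propositional.Properties using (∈-filter⁺; ∈-allFin)
import Data.List.Relation.Unary.All as All
open import Data.List.Relation.Unary.All.Properties using (all-filter)
open import Data.Nat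
  using (ℕ; zero; suc; _+_; _*_; _≤_; _<_; z≤n; s≤s; anyUpTo?; parity)
open import Data.Nat.Induction using (<-rec)
open import Data.Nat.Properties
  using ( ≤-trans; ≤-antisym; ≤-reflexive; <-irrefl; ≮⇒≥; <⇒≱; m<n⇒m<1+n; n<1+n; n≤1+n
        ; suc-injective; +-suc; +-comm; +-assoc; +-identityʳ; +-mono-≤; +-monoʳ-≤; +-monoʳ-<
        ; +-cancelˡ-≤; *-monoʳ-≤; *-suc; *-distribˡ-+; even≢odd; module ≤-Reasoning)
open import Data.Parity using (Parity; 0ℙ; 1ℙ; _⁻¹)
open import Data.Parity.Properties using (p≢p⁻¹; suc-homo-⁻¹) renaming (_≟_ to _≟ℙ_)
open import Data.Product using (∃; _×_; _,_; proj₁; proj₂)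
open import Data.Sum using (_⊎_; inj₁; inj₂; [_,_]′)
open import Data.Unit using (tt)
open import Data.Vec using (here; there)
import Data.Vec as Vec
open import Function using (_∘_; id)
open import Function.Bundles using (mk⇔)
open import Relation.Binary.Definitions using (DecidableEquality)
open import Relation.Binary.PropositionalEquality
  using (_≡_; _≢_; refl; sym; trans; cong; subst; module ≡-Reasoning)
open import Relation.Nullary using (¬_; yes; no; does; ¬?; contradiction)
open import Relation.Nullary.Decidable
  using (_×-dec_; _⊎-dec_; _→-dec_; decidable-stable; does-⇔; dec-true; dec-false)
open import Relation.Unary using (Pred; Decidable; _⊆_; _∩_; _∪_; ∁; U; Satisfiable)
open import Relation.Unary.Properties using (_∩?_; _∪?_; ∁?; U?)

-- Call a vertex lonely if no other vertex has its color. In a half-monochromatic k-coloring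
-- the lonely vertices are independent: on a face containing the edge uv, the color j that fills
-- half of the boundary either sits at u or v, and then (the face having at least three vertices)
-- also at some other vertex, or at neither, and then φ sends the j-colored boundary darts
-- injectively to the other ones while missing the dart leaving v, so j fills less than half.
-- Every other color class has at least two vertices, so 2k ≤ |V| + #lonely ≤ |V| + α.
--
-- A plane graph with even faces is bipartite, so |V| ≤ 2α. To see it, color the vertices by the
-- parity of their depth in a breadth-first spanning tree T. The edges outside T connect all faces,
-- and by Euler's formula they form a spanning tree T* of the dual. Edges of T are bichromatic, so a
-- monochromatic edge lies in T*, and one of maximal depth there is the only monochromatic edge of
-- its deeper face, which is impossible on an even face.

private variable
  ℓ₁ ℓ₂ ℓ₃ : Level

count : ∀ {n} {P : Pred (Fin n) ℓ₁} → Decidable P → ℕ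
count {n = zero}  P? = 0
count {n = suc n} P? with does (P? zero)
... | true  = suc (count (P? ∘ suc))
... | false = count (P? ∘ suc)

count-cong : ∀ {n} {P : Pred (Fin n) ℓ₁} {Q : Pred (Fin n) ℓ₂} (P? : Decidable P) (Q? : Decidable Q) →
             P ⊆ Q → Q ⊆ P → count P? ≡ count Q?
count-cong {n = zero}  P? Q? P⊆Q Q⊆P = refl
count-cong {n = suc n} P? Q? P⊆Q Q⊆P with P? zero | Q? zero
... | yes _  | yes _  = cong suc (count-cong (P? ∘ suc) (Q? ∘ suc) P⊆Q Q⊆P)
... | yes p₀ | no ¬q₀ = ⊥-elim (¬q₀ (P⊆Q p₀))
... | no ¬p₀ | yes q₀ = ⊥-elim (¬p₀ (Q⊆P q₀))
... | no _   | no _   = count-cong (P? ∘ suc) (Q? ∘ suc) P⊆Q Q⊆P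

count-split : ∀ {n} {P : Pred (Fin n) ℓ₁} {Q : Pred (Fin n) ℓ₂} (P? : Decidable P) (Q? : Decidable Q) →
              count P? ≡ count (P? ∩? Q?) + count (P? ∩? ∁? Q?)
count-split {n = zero}  P? Q? = refl
count-split {n = suc n} P? Q? with P? zero | Q? zero
... | yes _ | yes _ = cong suc (count-split (P? ∘ suc) (Q? ∘ suc))
... | yes _ | no _  = trans (cong suc (count-split (P? ∘ suc) (Q? ∘ suc))) (sym (+-suc _ _))
... | no _  | yes _ = count-split (P? ∘ suc) (Q? ∘ suc)
... | no _  | no _  = count-split (P? ∘ suc) (Q? ∘ suc)

count-complement : ∀ {n} {P : Pred (Fin n) ℓ₁} (P? : Decidable P) → count P? + count (∁? P?) ≡ n
count-complement {n = zero}  P? = refl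
count-complement {n = suc n} P? with P? zero
... | yes _ = cong suc (count-complement (P? ∘ suc))
... | no _  = trans (+-suc _ _) (cong suc (count-complement (P? ∘ suc)))

count-U : ∀ {n} → count (U? {A = Fin n}) ≡ n
count-U {n = zero}  = refl
count-U {n = suc n} = cong suc count-U

_-?_ : ∀ {n} {P : Pred (Fin n) ℓ₁} → Decidable P → (a : Fin n) → Decidable (P ∩ ∁ (_≡ a))
P? -? a = P? ∩? ∁? (_≟ a)

private
  -?-suc : ∀ {n} {P : Pred (Fin (suc n)) ℓ₁} (P? : Decidable P) (a : Fin n) →
           count ((P? ∘ suc) -? a) ≡ count ((P? -? suc a) ∘ suc)
  -?-suc P? a = count-cong ((P? ∘ suc) -? a) ((P? -? suc a) ∘ suc)
    (λ (p , x≢a) → p , x≢a ∘ Fin.suc-injective) (λ (p , x≢a) → p , x≢a ∘ cong suc)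

count-remove : ∀ {n} {P : Pred (Fin n) ℓ₁} (P? : Decidable P) {a : Fin n} → P a →
               count P? ≡ suc (count (P? -? a))
count-remove {n = suc n} P? {zero} p₀ with P? zero
... | no ¬p₀ = ⊥-elim (¬p₀ p₀)
... | yes _  = cong suc (count-cong (P? ∘ suc) ((P? -? zero) ∘ suc) (λ p → p , λ ()) proj₁)
count-remove {n = suc n} P? {suc a} pₐ with P? zero
... | yes _ = cong suc (trans (count-remove (P? ∘ suc) pₐ) (cong suc (-?-suc P? a)))
... | no _  = trans (count-remove (P? ∘ suc) pₐ) (cong suc (-?-suc P? a))

count-≤-injection : ∀ {n m} {P : Pred (Fin n) ℓ₁} {Q : Pred (Fin m) ℓ₂} (P? : Decidable P) (Q? : Decidable Q)
                    (f : ∀ {x} → P x → Fin m) → (∀ {x} (px : P x) → Q (f px)) →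
                    (∀ {x y} (px : P x) (py : P y) → f px ≡ f py → x ≡ y) → count P? ≤ count Q?
count-≤-injection {n = zero}  P? Q? f f∈Q f-inj = z≤n
count-≤-injection {n = suc n} P? Q? f f∈Q f-inj with P? zero
... | no _   = count-≤-injection (P? ∘ suc) Q? f f∈Q (λ px py → Fin.suc-injective ∘ f-inj px py)
... | yes p₀ = subst (suc (count (P? ∘ suc)) ≤_) (sym (count-remove Q? (f∈Q p₀)))
    (s≤s (count-≤-injection (P? ∘ suc) (Q? -? f p₀) f
      (λ px → f∈Q px , λ fx≡f₀ → 0≢1+n (sym (f-inj px p₀ fx≡f₀)))
      (λ px py → Fin.suc-injective ∘ f-inj px py)))

count-mono : ∀ {n} {P : Pred (Fin n) ℓ₁} {Q : Pred (Fin n) ℓ₂} (P? : Decidable P) (Q? : Decidable Q) →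
             P ⊆ Q → count P? ≤ count Q?
count-mono P? Q? P⊆Q = count-≤-injection P? Q? (λ {x} _ → x) P⊆Q (λ _ _ → id)

count-≤ : ∀ {n} {P : Pred (Fin n) ℓ₁} (P? : Decidable P) → count P? ≤ n
count-≤ P? = subst (count P? ≤_) count-U (count-mono P? U? _)

count-< : ∀ {n} {P : Pred (Fin n) ℓ₁} {Q : Pred (Fin n) ℓ₂} (P? : Decidable P) (Q? : Decidable Q) →
          P ⊆ Q → {a : Fin n} → Q a → ¬ P a → count P? < count Q?
count-< P? Q? P⊆Q {a} qₐ ¬pₐ = subst (count P? <_) (sym (count-remove Q? qₐ))
  (s≤s (count-mono P? (Q? -? a) (λ {x} px → P⊆Q px , λ { refl → ¬pₐ px })))

count-disjoint : ∀ {n} {P : Pred (Fin n) ℓ₁} {Q : Pred (Fin n) ℓ₂} {S : Pred (Fin n) ℓ₃}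
                 (P? : Decidable P) (Q? : Decidable Q) (S? : Decidable S) →
                 P ⊆ S → Q ⊆ S → (∀ {x} → P x → ¬ Q x) → count P? + count Q? ≤ count S?
count-disjoint P? Q? S? P⊆S Q⊆S P∩Q=∅ = subst (count P? + count Q? ≤_) (sym (count-split S? P?))
  (+-mono-≤ (count-mono P? (S? ∩? P?) (λ px → P⊆S px , px))
            (count-mono Q? (S? ∩? ∁? P?) (λ qx → Q⊆S qx , λ px → P∩Q=∅ px qx)))

count-satisfiable : ∀ {n} {P : Pred (Fin n) ℓ₁} (P? : Decidable P) → 0 < count P? → Satisfiable P
count-satisfiable {n = suc n} P? pos with P? zero
... | yes p₀ = zero , p₀
... | no _   = let x , px = count-satisfiable (P? ∘ suc) pos in suc x , px

length-filter-tabulate : ∀ {n} {A : Set} {P : Pred A ℓ₁} (P? : Decidable P) (f : Fin n → A) →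
                         length (filter P? (tabulate f)) ≡ count (P? ∘ f)
length-filter-tabulate {n = zero}  P? f = refl
length-filter-tabulate {n = suc n} P? f with does (P? (f zero))
... | true  = cong suc (length-filter-tabulate P? (f ∘ suc))
... | false = length-filter-tabulate P? (f ∘ suc)

length-filter-allFin : ∀ {n} {P : Pred (Fin n) ℓ₁} (P? : Decidable P) →
                       length (filter P? (allFin n)) ≡ count P?
length-filter-allFin P? = length-filter-tabulate P? id

toSubset : ∀ {n} {P : Pred (Fin n) ℓ₁} → Decidable P → Subset n
toSubset P? = Vec.tabulate (does ∘ P?)

∣toSubset∣ : ∀ {n} {P : Pred (Fin n) ℓ₁} (P? : Decidable P) → ∣ toSubset P? ∣ ≡ count P?
∣toSubset∣ {n = zero}  P? = refl
∣toSubset∣ {n = suc n} P? with does (P? zero)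
... | true  = cong suc (∣toSubset∣ (P? ∘ suc))
... | false = ∣toSubset∣ (P? ∘ suc)

∈-toSubset⁻ : ∀ {n} {P : Pred (Fin n) ℓ₁} (P? : Decidable P) {x : Fin n} → x ∈ₛ toSubset P? → P x
∈-toSubset⁻ P? {zero}  x∈ with P? zero
∈-toSubset⁻ P? {zero}  here | yes p₀ = p₀
∈-toSubset⁻ P? {suc x} (there x∈) = ∈-toSubset⁻ (P? ∘ suc) x∈

Least : Pred ℕ ℓ₁ → Set ℓ₁
Least P = ∃ λ i → P i × (∀ {k} → P k → i ≤ k)

least-witness : {P : Pred ℕ ℓ₁} → Decidable P → ∀ {j} → P j → Least P
least-witness {P = P} P? = <-rec (λ j → P j → Least P) search _
  where
  search : ∀ j → (∀ {i} → i < j → P i → Least P) → P j → Least P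
  search j rec pj with anyUpTo? P? j
  ... | yes (i , i<j , pi) = rec i<j pi
  ... | no none            = j , pj , λ {k} pk → ≮⇒≥ (λ k<j → none (k , k<j , pk))

argmax-on : ∀ {n} {Z : Pred (Fin n) ℓ₁} → Decidable Z → (f : Fin n → ℕ) → Satisfiable Z →
            ∃ λ y → Z y × (∀ {z} → Z z → f z ≤ f y)
argmax-on {n = n} Z? f (w , zw) =
  argmax f w zs , argmax-all f zw (all-filter Z? (allFin n)) ,
  λ zz → All.lookup (f[xs]≤f[argmax] w zs) (∈-filter⁺ Z? (∈-allFin _) zz)
  where
  zs : List (Fin n)
  zs = filter Z? (allFin n)

-- Breadth-first spanning tree, rooted at src root, of the graph on Fin n whose edges are the pairs
-- {x, inv x} of darts in A. Connectivity is assumed in the form of an induction principle.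
module SpanningTree
  {n d : ℕ} (src : Fin d → Fin n) (inv : Fin d → Fin d) (inv-involutive : ∀ x → inv (inv x) ≡ x)
  {A : Pred (Fin d) 0ℓ} (A? : Decidable A) (A-inv : ∀ x → A x → A (inv x))
  (root : Fin d)
  (connected : ∀ {X : Pred (Fin n) 0ℓ} → Decidable X → X (src root) →
               (∀ {x} → A x → X (src x) → X (src (inv x))) → ∀ v → X v)
  where

  r : Fin n
  r = src root

  tgt : Fin d → Fin n
  tgt x = src (inv x)

  Ball : ℕ → Pred (Fin n) 0ℓ
  Ball zero    v = v ≡ r
  Ball (suc i) v = Ball i v ⊎ ∃ λ x → A x × src x ≡ v × Ball i (tgt x)

  ball? : ∀ i → Decidable (Ball i)
  ball? zero    v = v ≟ r
  ball? (suc i) v = ball? i v ⊎-dec any? (λ x → A? x ×-dec src x ≟ v ×-dec ball? i (tgt x))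

  r∈Ball : ∀ i → Ball i r
  r∈Ball zero    = refl
  r∈Ball (suc i) = inj₁ (r∈Ball i)

  Growing : ℕ → Set
  Growing i = ∃ λ v → Ball (suc i) v × ¬ Ball i v

  growing? : Decidable Growing
  growing? i = any? (λ v → ball? (suc i) v ×-dec ¬? (ball? i v))

  count-Ball-grows : ∀ k → (∀ {i} → i < k → Growing i) → k < count (ball? k)
  count-Ball-grows zero    _    = subst (0 <_) (sym (count-remove (ball? 0) refl)) (s≤s z≤n)
  count-Ball-grows (suc k) grow = let _ , ∈ball-v , ∉ball-v = grow (n<1+n k) in
    ≤-trans (s≤s (count-Ball-grows k (grow ∘ m<n⇒m<1+n)))
            (count-< (ball? k) (ball? (suc k)) inj₁ ∈ball-v ∉ball-v)

  stabilises : ∃ λ s → Ball (suc s) ⊆ Ball s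
  stabilises with anyUpTo? (¬? ∘ growing?) n
  ... | yes (s , _ , ¬grow) =
    s , λ {v} ∈ball-v → decidable-stable (ball? s v) (λ ∉ball-v → ¬grow (v , ∈ball-v , ∉ball-v))
  ... | no none = ⊥-elim (<-irrefl refl (≤-trans (count-Ball-grows n grow) (count-≤ (ball? n))))
    where
    grow : ∀ {i} → i < n → Growing i
    grow {i} i<n = decidable-stable (growing? i) (λ ¬grow → none (i , i<n , ¬grow))

  ball-covers : ∀ v → Ball (proj₁ stabilises) v
  ball-covers = connected (ball? s) (r∈Ball s) closed
    where
    s : ℕ
    s = proj₁ stabilises

    closed : ∀ {x} → A x → Ball s (src x) → Ball s (tgt x)
    closed {x} a ∈ball-src = proj₂ stabilises
      (inj₂ (inv x , A-inv x a , refl , subst (Ball s ∘ src) (sym (inv-involutive x)) ∈ball-src))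

  opaque
    depth : Fin n → ℕ
    depth v = proj₁ (least-witness (λ i → ball? i v) (ball-covers v))

    ball-depth : ∀ v → Ball (depth v) v
    ball-depth v = proj₁ (proj₂ (least-witness (λ i → ball? i v) (ball-covers v)))

    depth-minimal : ∀ {i v} → Ball i v → depth v ≤ i
    depth-minimal {v = v} = proj₂ (proj₂ (least-witness (λ i → ball? i v) (ball-covers v)))

  parent-dart : ∀ v → v ≢ r → ∃ λ x → A x × src x ≡ v × suc (depth (tgt x)) ≡ depth v
  parent-dart v v≢r with depth v in depth-v | ball-depth v
  ... | zero  | v≡r = contradiction v≡r v≢r
  ... | suc j | inj₁ ∈ball-j =
    contradiction (≤-trans (≤-reflexive (sym depth-v)) (depth-minimal ∈ball-j)) (<-irrefl refl)
  ... | suc j | inj₂ (x , a , src-x , ∈ball-tgt) = x , a , src-x , ≤-antisym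
    (s≤s (depth-minimal ∈ball-tgt))
    (≤-trans (≤-reflexive (sym depth-v)) (depth-minimal (inj₂ (x , a , src-x , ball-depth (tgt x)))))

  -- parent r is a junk value.
  parent : Fin n → Fin d
  parent v with v ≟ r
  ... | yes _   = root
  ... | no v≢r  = proj₁ (parent-dart v v≢r)

  parent-spec : ∀ {v} → v ≢ r → A (parent v) × src (parent v) ≡ v × suc (depth (tgt (parent v))) ≡ depth v
  parent-spec {v} v≢r with v ≟ r
  ... | yes v≡r  = contradiction v≡r v≢r
  ... | no v≢r′ = proj₂ (parent-dart v v≢r′)

  src-parent : ∀ {v} → v ≢ r → src (parent v) ≡ v
  src-parent = proj₁ ∘ proj₂ ∘ parent-spec

  ParentDart : Pred (Fin d) 0ℓ
  ParentDart x = src x ≢ r × parent (src x) ≡ x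

  parentDart? : Decidable ParentDart
  parentDart? x = ¬? (src x ≟ r) ×-dec parent (src x) ≟ x

  TreeDart : Pred (Fin d) 0ℓ
  TreeDart x = ParentDart x ⊎ ParentDart (inv x)

  treeDart? : Decidable TreeDart
  treeDart? x = parentDart? x ⊎-dec parentDart? (inv x)

  parent-ParentDart : ∀ {v} → v ≢ r → ParentDart (parent v)
  parent-ParentDart v≢r = (λ src≡r → v≢r (trans (sym (src-parent v≢r)) src≡r)) , cong parent (src-parent v≢r)

  parent-injective : ∀ {v w} → v ≢ r → w ≢ r → parent v ≡ parent w → v ≡ w
  parent-injective v≢r w≢r eq = trans (sym (src-parent v≢r)) (trans (cong src eq) (src-parent w≢r))

  ParentDart⇒depth : ∀ {x} → ParentDart x → suc (depth (tgt x)) ≡ depth (src x)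
  ParentDart⇒depth {x} (src≢r , parent≡x) =
    subst (λ y → suc (depth (tgt y)) ≡ depth (src x)) parent≡x (proj₂ (proj₂ (parent-spec src≢r)))

  ChildDart⇒depth : ∀ {x} → ParentDart (inv x) → suc (depth (src x)) ≡ depth (tgt x)
  ChildDart⇒depth {x} down =
    subst (λ y → suc (depth (src y)) ≡ depth (tgt x)) (inv-involutive x) (ParentDart⇒depth down)

  ParentDart⇒A : ParentDart ⊆ A
  ParentDart⇒A (src≢r , parent≡x) = subst A parent≡x (proj₁ (parent-spec src≢r))

  TreeDart⇒A : TreeDart ⊆ A
  TreeDart⇒A     (inj₁ up)   = ParentDart⇒A up
  TreeDart⇒A {x} (inj₂ down) = subst A (inv-involutive x) (A-inv _ (ParentDart⇒A down))

  TreeDart-inv : ∀ {x} → TreeDart x → TreeDart (inv x)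
  TreeDart-inv {x} (inj₁ up)   = inj₂ (subst ParentDart (sym (inv-involutive x)) up)
  TreeDart-inv     (inj₂ down) = inj₁ down

  ParentDart-inv : ∀ {x} → ParentDart x → ¬ ParentDart (inv x)
  ParentDart-inv up down = <-irrefl refl (≤-trans (n≤1+n _)
    (≤-trans (s≤s (≤-reflexive (ParentDart⇒depth up))) (≤-reflexive (ChildDart⇒depth down))))

  tree-size : 2 * n ≤ 2 + count treeDart?
  tree-size = begin
    2 * n                                 ≤⟨ *-monoʳ-≤ 2 nonroot↪parent ⟩
    2 * suc c                             ≡⟨ *-suc 2 c ⟩
    2 + (c + (c + 0))                     ≡⟨ cong (λ k → 2 + (c + k)) (+-identityʳ c) ⟩
    2 + (c + c)                           ≤⟨ s≤s (s≤s (+-monoʳ-≤ c parent↪child)) ⟩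
    2 + (c + count (parentDart? ∘ inv))   ≤⟨ s≤s (s≤s up+down≤tree) ⟩
    2 + count treeDart?                   ∎
    where
    open ≤-Reasoning
    c : ℕ
    c = count parentDart?

    nonroot↪parent : n ≤ suc c
    nonroot↪parent = begin
      n                        ≡⟨ count-U ⟨
      count (U? {A = Fin n})   ≡⟨ count-remove U? {r} _ ⟩
      suc (count (U? -? r))    ≤⟨ s≤s (count-≤-injection (U? -? r) parentDart? (λ {v} _ → parent v)
                                 (λ (_ , v≢r) → parent-ParentDart v≢r)
                                 (λ (_ , v≢r) (_ , w≢r) → parent-injective v≢r w≢r)) ⟩
      suc c                    ∎

    parent↪child : c ≤ count (parentDart? ∘ inv)
    parent↪child = count-≤-injection parentDart? (parentDart? ∘ inv) (λ {x} _ → inv x)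
      (λ {x} up → subst ParentDart (sym (inv-involutive x)) up)
      (λ {x} {y} _ _ inv≡ → trans (sym (inv-involutive x)) (trans (cong inv inv≡) (inv-involutive y)))

    up+down≤tree : c + count (parentDart? ∘ inv) ≤ count treeDart?
    up+down≤tree = count-disjoint parentDart? (parentDart? ∘ inv) treeDart? inj₁ inj₂ ParentDart-inv

  pendant : ∀ {Z : Pred (Fin d) 0ℓ} → Decidable Z → (∀ {x} → Z x → Z (inv x)) → Z ⊆ TreeDart →
            Satisfiable Z → ∃ λ y → Z y × (∀ {z} → Z z → src z ≡ src y → z ≡ y)
  pendant {Z} Z? Z-inv Z⊆tree nonempty with argmax-on Z? (depth ∘ src) nonempty
  ... | y , z-y , deepest = y , z-y , unique
    where
    deepest-is-up : ∀ {z} → Z z → depth (src z) ≡ depth (src y) → ParentDart z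
    deepest-is-up {z} z-z same with Z⊆tree z-z
    ... | inj₁ up   = up
    ... | inj₂ down = contradiction (deepest (Z-inv z-z))
      (<⇒≱ (≤-trans (s≤s (≤-reflexive (sym same))) (≤-reflexive (ChildDart⇒depth down))))

    unique : ∀ {z} → Z z → src z ≡ src y → z ≡ y
    unique z-z src≡ = trans (sym (proj₂ (deepest-is-up z-z (cong depth src≡))))
                            (trans (cong parent src≡) (proj₂ (deepest-is-up z-y refl)))

p≢q⇒p≡q⁻¹ : ∀ {p q : Parity} → p ≢ q → p ≡ q ⁻¹
p≢q⇒p≡q⁻¹ {0ℙ} {0ℙ} p≢q = contradiction refl p≢q
p≢q⇒p≡q⁻¹ {0ℙ} {1ℙ} _   = refl
p≢q⇒p≡q⁻¹ {1ℙ} {0ℙ} _   = refl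
p≢q⇒p≡q⁻¹ {1ℙ} {1ℙ} p≢q = contradiction refl p≢q

parity-suc≢ : ∀ {n} → parity (suc n) ≢ parity n
parity-suc≢ {n} eq = p≢p⁻¹ (parity (suc n)) (trans eq (sym (suc-homo-⁻¹ n)))

≢-≢⇒≡ : ∀ {p q r : Parity} → p ≢ q → q ≢ r → p ≡ r
≢-≢⇒≡ p≢q q≢r = trans (p≢q⇒p≡q⁻¹ p≢q) (sym (p≢q⇒p≡q⁻¹ (q≢r ∘ sym)))

module PlaneMap {G : RotationSystem} (plane : IsPlaneSimpleGraph G) where

  open RotationSystem G
  open IsPlaneSimpleGraph plane

  rev-injective : ∀ {x y} → rev x ≡ rev y → x ≡ y
  rev-injective {x} {y} eq = trans (sym (rev-invol x)) (trans (cong rev eq) (rev-invol y))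

  rot-injective : ∀ {x y} → rot x ≡ rot y → x ≡ y
  rot-injective {x} {y} eq = trans (sym (rot-inv₂ x)) (trans (cong rot⁻¹ eq) (rot-inv₂ y))

  φ-injective : ∀ {x y} → φ x ≡ φ y → x ≡ y
  φ-injective = rev-injective ∘ rot-injective

  face-φ : ∀ x → face (φ x) ≡ face x
  face-φ x = face-orbit₂ x 1

  tail-φ : ∀ x → tail (φ x) ≡ tail (rev x)
  tail-φ x = rot-tail (rev x)

  face-rot : ∀ x → face (rot x) ≡ face (rev x)
  face-rot x = trans (cong (face ∘ rot) (sym (rev-invol x))) (face-φ (rev x))

  onFace? : (f : Fin nF) → Decidable (λ x → face x ≡ f)
  onFace? f x = face x ≟ f

  faceLength≡count : ∀ f → faceLength f ≡ count (onFace? f)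
  faceLength≡count f = length-filter-allFin (onFace? f)

  rot-φ-invariant⇒constant : ∀ {B : Set} (h : Fin nD → B) → (∀ x → h (rot x) ≡ h x) → (∀ x → h (φ x) ≡ h x) →
                             ∀ x y → h x ≡ h y
  rot-φ-invariant⇒constant h h-rot h-φ x y = along (connected (tail x) (tail y)) x y refl refl
    where
    around : ∀ {x y} → tail x ≡ tail y → h x ≡ h y
    around {x} {y} same = let k , rotᵏx≡y = rot-trans x y same in trans (sym (iterate k x)) (cong h rotᵏx≡y)
      where
      iterate : ∀ k x → h (iter rot k x) ≡ h x
      iterate zero    x = refl
      iterate (suc k) x = trans (h-rot _) (iterate k x)

    along : ∀ {u w} → Reachable G u w → ∀ x y → tail x ≡ u → tail y ≡ w → h x ≡ h y
    along here       x y tail-x tail-y = around (trans tail-x (sym tail-y))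
    along (step z p) x y tail-x tail-y =
      trans (around tail-x) (trans (sym (h-φ z)) (along p (φ z) y (tail-φ z) tail-y))

  ¬unique-change-around-vertex : ∀ {B : Set} → DecidableEquality B → (h : Fin nD → B) {d : Fin nD} →
    h d ≢ h (rot d) → (∀ {z} → tail z ≡ tail d → h z ≢ h (rot z) → z ≡ d) → ⊥
  ¬unique-change-around-vertex _≟B_ h {d} change-at-d unique =
    <-irrefl refl (≤-trans (≤-reflexive (sym count-with-d)) rot-injects)
    where
    Other : Pred (Fin nD) 0ℓ
    Other z = tail z ≡ tail d × h z ≢ h d

    other? : Decidable Other
    other? z = tail z ≟ tail d ×-dec ¬? (h z ≟B h d)

    count-with-d : count (other? ∪? (_≟ d)) ≡ suc (count other?)
    count-with-d = trans (count-remove (other? ∪? (_≟ d)) (inj₂ refl)) (cong suc (count-cong _ other?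
      (λ { (inj₁ other , _) → other ; (inj₂ z≡d , z≢d) → contradiction z≡d z≢d })
      (λ (same-vertex , hz≢hd) → inj₁ (same-vertex , hz≢hd) , λ { refl → hz≢hd refl })))

    rot-other : ∀ {z} → Other z ⊎ z ≡ d → Other (rot z)
    rot-other {z} (inj₁ (same-vertex , hz≢hd)) = trans (rot-tail z) same-vertex ,
      λ hrz≡hd → hz≢hd (cong h (unique same-vertex (λ hz≡hrz → hz≢hd (trans hz≡hrz hrz≡hd))))
    rot-other (inj₂ refl) = rot-tail d , λ hrd≡hd → change-at-d (sym hrd≡hd)

    rot-injects : count (other? ∪? (_≟ d)) ≤ count other?
    rot-injects = count-≤-injection (other? ∪? (_≟ d)) other? (λ {z} _ → rot z) rot-other
                                    (λ _ _ → rot-injective)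

  -- On the face of b, φ maps the darts whose tail has the color of tail b, other than b, injectively
  -- to the remaining darts, and these back to the former, other than φ b; so the face length is odd.
  ¬unique-monochromatic-edge : (σ : Fin nV → Parity) {b : Fin nD} → (∃ λ m → faceLength (face b) ≡ 2 * m) →
    σ (tail b) ≡ σ (tail (rev b)) → (∀ {z} → face z ≡ face b → σ (tail z) ≡ σ (tail (rev z)) → z ≡ b) → ⊥
  ¬unique-monochromatic-edge σ {b} (m , even) mono-b unique = even≢odd m c (begin
    2 * m                      ≡⟨ even ⟨
    faceLength (face b)        ≡⟨ faceLength≡count (face b) ⟩
    count (onFace? (face b))   ≡⟨ count-split (onFace? (face b)) like-b? ⟩
    count same? + c′           ≡⟨ cong (_+ c′) (count-remove same? (refl , refl)) ⟩
    suc (c + c′)               ≡⟨ cong (λ k → suc (c + k)) (sym c≡c′) ⟩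
    suc (c + c)                ≡⟨ cong (λ k → suc (c + k)) (+-identityʳ c) ⟨
    suc (2 * c)                ∎)
    where
    open ≡-Reasoning
    like-b? : Decidable (λ z → σ (tail z) ≡ σ (tail b))
    like-b? z = σ (tail z) ≟ℙ σ (tail b)

    same? : Decidable (λ z → face z ≡ face b × σ (tail z) ≡ σ (tail b))
    same? = onFace? (face b) ∩? like-b?

    diff? : Decidable (λ z → face z ≡ face b × σ (tail z) ≢ σ (tail b))
    diff? = onFace? (face b) ∩? ∁? like-b?

    c c′ : ℕ
    c  = count (same? -? b)
    c′ = count diff?

    bichromatic : ∀ {z} → face z ≡ face b → z ≢ b → σ (tail (φ z)) ≢ σ (tail z)
    bichromatic {z} on-face z≢b σφz≡σz =
      z≢b (unique on-face (sym (trans (sym (cong σ (tail-φ z))) σφz≡σz)))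

    φ-same→diff : c ≤ c′
    φ-same→diff = count-≤-injection (same? -? b) diff? (λ {z} _ → φ z)
      (λ {z} ((on-face , σz≡σb) , z≢b) →
         trans (face-φ z) on-face , λ σφz≡σb → bichromatic on-face z≢b (trans σφz≡σb (sym σz≡σb)))
      (λ _ _ → φ-injective)

    φ-diff→same : c′ ≤ count (same? -? φ b)
    φ-diff→same = count-≤-injection diff? (same? -? φ b) (λ {z} _ → φ z)
      (λ {z} (on-face , σz≢σb) → let z≢b = λ { refl → σz≢σb refl } in
         (trans (face-φ z) on-face , ≢-≢⇒≡ (bichromatic on-face z≢b) σz≢σb) , z≢b ∘ φ-injective)
      (λ _ _ → φ-injective)

    remove-b≡remove-φb : count (same? -? φ b) ≡ c
    remove-b≡remove-φb = suc-injective (trans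
      (sym (count-remove same? (face-φ b , trans (cong σ (tail-φ b)) (sym mono-b))))
      (count-remove same? (refl , refl)))

    c≡c′ : c ≡ c′
    c≡c′ = ≤-antisym φ-same→diff (subst (c′ ≤_) remove-b≡remove-φb φ-diff→same)

module TreeCotree {G : RotationSystem} (plane : IsPlaneSimpleGraph G) (root : Fin (RotationSystem.nD G)) where

  open RotationSystem G
  open IsPlaneSimpleGraph plane
  open PlaneMap plane

  private
    U-rev : ∀ (x : Fin nD) → U x → U (rev x)
    U-rev _ _ = tt

  vertex-induction : ∀ {X : Pred (Fin nV) 0ℓ} → Decidable X → X (tail root) →
                     (∀ {x} → U x → X (tail x) → X (tail (rev x))) → ∀ v → X v
  vertex-induction {X} _ x-root closed v = along (connected v (tail root)) x-root
    where
    along : ∀ {u w} → Reachable G u w → X w → X u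
    along here       x-w = x-w
    along (step x p) x-w = subst (X ∘ tail) (rev-invol x) (closed tt (along p x-w))

  module Primal = SpanningTree tail rev rev-invol (U? {A = Fin nD}) U-rev root vertex-induction

  Cotree : Pred (Fin nD) 0ℓ
  Cotree = ∁ Primal.TreeDart

  cotree-rev : ∀ x → Cotree x → Cotree (rev x)
  cotree-rev x cotree tree = cotree (subst Primal.TreeDart (rev-invol x) (Primal.TreeDart-inv tree))

  -- If X missed a face, the darts crossing between X and its complement would be primal tree darts,
  -- and around the tail of a pendant one the side of X would change exactly once.
  face-induction : ∀ {X : Pred (Fin nF) 0ℓ} → Decidable X → X (face root) →
                   (∀ {x} → Cotree x → X (face x) → X (face (rev x))) → ∀ f → X f
  face-induction {X} X? x-root closed f = decidable-stable (X? f) λ ¬x-f →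
    let y , crossing-y , unique = Primal.pendant crossing? crossing-rev crossing⇒tree (crossing-exists ¬x-f) in
    ¬unique-change-around-vertex Bool._≟_ h (λ hy≡hry → crossing-y (trans hy≡hry (h-rot y)))
      (λ same-vertex change → unique (λ hz≡hrz → change (trans hz≡hrz (sym (h-rot _)))) same-vertex)
    where
    open ≡-Reasoning

    h : Fin nD → Bool
    h x = does (X? (face x))

    h-rot : ∀ x → h (rot x) ≡ h (rev x)
    h-rot x = cong (does ∘ X?) (face-rot x)

    Crossing : Pred (Fin nD) 0ℓ
    Crossing x = h x ≢ h (rev x)

    crossing? : Decidable Crossing
    crossing? x = ¬? (h x Bool.≟ h (rev x))

    crossing-rev : ∀ {x} → Crossing x → Crossing (rev x)
    crossing-rev {x} crossing hrx≡hrrx = crossing (sym (trans hrx≡hrrx (cong h (rev-invol x))))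

    crossing⇒tree : Crossing ⊆ Primal.TreeDart
    crossing⇒tree {x} crossing = decidable-stable (Primal.treeDart? x) λ cotree →
      crossing (does-⇔ (mk⇔ (closed cotree) (subst (X ∘ face) (rev-invol x) ∘ closed (cotree-rev x cotree)))
                       (X? (face x)) (X? (face (rev x))))

    crossing-exists : ¬ X f → Satisfiable Crossing
    crossing-exists ¬x-f = decidable-stable (any? crossing?) λ none →
      let no-crossing = λ x → decidable-stable (h x Bool.≟ h (rev x)) (λ crossing → none (x , crossing))
          b , face-b  = face-surj f
      in contradiction (begin
        true        ≡⟨ dec-true (X? (face root)) x-root ⟨
        h root      ≡⟨ rot-φ-invariant⇒constant h (λ x → trans (h-rot x) (sym (no-crossing x)))
                                                   (λ x → cong (does ∘ X?) (face-φ x)) root b ⟩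
        h b         ≡⟨ dec-false (X? (face b)) (¬x-f ∘ subst X face-b) ⟩
        false       ∎) λ ()

  module Dual = SpanningTree face rev rev-invol (∁? Primal.treeDart?) cotree-rev root face-induction

  -- The two trees have |V| - 1 and |F| - 1 edges, which by Euler's formula is all of them.
  primal-or-dual-tree : ∀ x → Primal.TreeDart x ⊎ Dual.TreeDart x
  primal-or-dual-tree x = decidable-stable (either? x) λ neither →
    <-irrefl refl (≤-trans (count-< either? U? _ tt neither) (subst (_≤ count either?) (sym count-U) covered))
    where
    either? : Decidable (Primal.TreeDart ∪ Dual.TreeDart)
    either? = Primal.treeDart? ∪? Dual.treeDart?

    cP cQ : ℕ
    cP = count Primal.treeDart?
    cQ = count Dual.treeDart?

    covered : nD ≤ count either?
    covered = +-cancelˡ-≤ 4 _ _ (begin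
      4 + nD                  ≡⟨ +-comm 4 nD ⟩
      nD + 4                  ≡⟨ euler ⟨
      2 * (nV + nF)           ≡⟨ *-distribˡ-+ 2 nV nF ⟩
      2 * nV + 2 * nF         ≤⟨ +-mono-≤ Primal.tree-size Dual.tree-size ⟩
      (2 + cP) + (2 + cQ)     ≡⟨ cong (2 +_) (+-comm cP (2 + cQ)) ⟩
      4 + (cQ + cP)           ≡⟨ cong (4 +_) (+-comm cQ cP) ⟩
      4 + (cP + cQ)           ≤⟨ +-monoʳ-≤ 4 (count-disjoint Primal.treeDart? Dual.treeDart? either? inj₁ inj₂
                                                (λ tree dual → Dual.TreeDart⇒A dual tree)) ⟩
      4 + count either?       ∎)
      where open ≤-Reasoning

  parity-coloring : Fin nV → Parity
  parity-coloring v = parity (Primal.depth v)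

  parity-coloring-proper : (∀ f → ∃ λ m → faceLength f ≡ 2 * m) →
                           ∀ x → parity-coloring (tail x) ≢ parity-coloring (tail (rev x))
  parity-coloring-proper even x mono-x =
    let y , mono-y , unique = Dual.pendant mono? mono-rev mono⇒dual (x , mono-x) in
    ¬unique-monochromatic-edge parity-coloring (even (face y)) mono-y (λ on-face mono → unique mono on-face)
    where
    Mono : Pred (Fin nD) 0ℓ
    Mono x = parity-coloring (tail x) ≡ parity-coloring (tail (rev x))

    mono? : Decidable Mono
    mono? x = parity-coloring (tail x) ≟ℙ parity-coloring (tail (rev x))

    mono-rev : ∀ {x} → Mono x → Mono (rev x)
    mono-rev {x} mono = trans (sym mono) (cong (parity-coloring ∘ tail) (sym (rev-invol x)))

    parent-bichromatic : ∀ {x} → Primal.ParentDart x → ¬ Mono x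
    parent-bichromatic {x} up mono =
      parity-suc≢ {Primal.depth (tail (rev x))} (trans (cong parity (Primal.ParentDart⇒depth up)) mono)

    tree-bichromatic : ∀ {x} → Primal.TreeDart x → ¬ Mono x
    tree-bichromatic (inj₁ up)   mono = parent-bichromatic up mono
    tree-bichromatic (inj₂ down) mono = parent-bichromatic down (mono-rev mono)

    mono⇒dual : Mono ⊆ Dual.TreeDart
    mono⇒dual {x} mono = [ (λ tree → contradiction mono (tree-bichromatic tree)) , id ]′ (primal-or-dual-tree x)

module _ {G : RotationSystem} (plane : IsPlaneSimpleGraph G) where

  open RotationSystem G

  two-coloring : (∀ f → ∃ λ m → faceLength f ≡ 2 * m) →
                 ∃ λ (σ : Fin nV → Parity) → ∀ x → σ (tail x) ≢ σ (tail (rev x))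
  two-coloring even with any? (U? {A = Fin nD})
  ... | yes (root , _) = parity-coloring , parity-coloring-proper even
    where open TreeCotree plane root
  ... | no no-dart     = (λ _ → 0ℙ) , λ x → contradiction (x , _) no-dart

module Fibres {n k : ℕ} (col : Fin n → Fin k) (onto : ∀ j → ∃ λ v → col v ≡ j) where

  Lonely : Pred (Fin n) 0ℓ
  Lonely v = ∀ w → col w ≡ col v → w ≡ v

  lonely? : Decidable Lonely
  lonely? v = all? (λ w → col w ≟ col v →-dec w ≟ v)

  ¬lonely⇒mate : ∀ {v} → ¬ Lonely v → ∃ λ w → col w ≡ col v × w ≢ v
  ¬lonely⇒mate {v} ¬lonely =
    let w , ¬[same⇒≡] = ¬∀⟶∃¬ n _ (λ w → col w ≟ col v →-dec w ≟ v) ¬lonely in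
    w , decidable-stable (col w ≟ col v) (λ ¬same → ¬[same⇒≡] (λ same → contradiction same ¬same)) ,
        λ w≡v → ¬[same⇒≡] (λ _ → w≡v)

  rep : Fin k → Fin n
  rep j = proj₁ (onto j)

  col-rep : ∀ j → col (rep j) ≡ j
  col-rep j = proj₂ (onto j)

  rep-injective : ∀ {i j} → rep i ≡ rep j → i ≡ j
  rep-injective {i} {j} eq = trans (sym (col-rep i)) (trans (cong col eq) (col-rep j))

  IsRep : Pred (Fin n) 0ℓ
  IsRep v = rep (col v) ≡ v

  isRep? : Decidable IsRep
  isRep? v = rep (col v) ≟ v

  twice-fibres≤points+lonely : k + k ≤ n + count lonely?
  twice-fibres≤points+lonely = begin
    k + k                                             ≡⟨ cong (k +_) (count-complement lonely-rep?) ⟨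
    k + (count lonely-rep? + count (∁? lonely-rep?))  ≡⟨ cong (k +_) (+-comm (count lonely-rep?) _) ⟩
    k + (count (∁? lonely-rep?) + count lonely-rep?)  ≡⟨ +-assoc k _ _ ⟨
    k + count (∁? lonely-rep?) + count lonely-rep?    ≤⟨ +-mono-≤ (+-mono-≤ reps mates) lonely-reps ⟩
    count isRep? + count (∁? isRep?) + count lonely?  ≡⟨ cong (_+ count lonely?) (count-complement isRep?) ⟩
    n + count lonely?                                 ∎
    where
    open ≤-Reasoning
    lonely-rep? : Decidable (Lonely ∘ rep)
    lonely-rep? = lonely? ∘ rep

    reps : k ≤ count isRep?
    reps = subst (_≤ count isRep?) count-U
      (count-≤-injection U? isRep? (λ {j} _ → rep j) (λ {j} _ → cong rep (col-rep j)) (λ _ _ → rep-injective))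

    mates : count (∁? lonely-rep?) ≤ count (∁? isRep?)
    mates = count-≤-injection (∁? lonely-rep?) (∁? isRep?) (λ crowded → proj₁ (¬lonely⇒mate crowded))
      (λ {j} crowded → let w , same , w≢rep = ¬lonely⇒mate crowded in
         λ isRep-w → w≢rep (trans (sym isRep-w) (cong rep (trans same (col-rep j)))))
      (λ {i} {j} ci cj mate≡ → let _ , same-i , _ = ¬lonely⇒mate ci
                                   _ , same-j , _ = ¬lonely⇒mate cj in
         trans (sym (col-rep i)) (trans (sym same-i) (trans (cong col mate≡) (trans same-j (col-rep j)))))

    lonely-reps : count lonely-rep? ≤ count lonely?
    lonely-reps = count-≤-injection lonely-rep? lonely? (λ {j} _ → rep j) (λ lonely → lonely)
                                    (λ _ _ → rep-injective)

module Independence (G : RotationSystem) {α : ℕ}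
  (max-independent : ∀ S → Independent G S → ∣ S ∣ ≤ α) where

  open RotationSystem G

  independent-count≤ : ∀ {P : Pred (Fin nV) 0ℓ} (P? : Decidable P) →
                       (∀ x → P (tail x) → ¬ P (tail (rev x))) → count P? ≤ α
  independent-count≤ P? independent = subst (_≤ α) (∣toSubset∣ P?) (max-independent (toSubset P?)
    (λ _ _ (x , tail-x , head-x) u∈S v∈S → independent x
      (subst _ (sym tail-x) (∈-toSubset⁻ P? u∈S)) (subst _ (sym head-x) (∈-toSubset⁻ P? v∈S))))

  two-colorable⇒≤2α : (∃ λ (σ : Fin nV → Parity) → ∀ x → σ (tail x) ≢ σ (tail (rev x))) → nV ≤ α + α
  two-colorable⇒≤2α (σ , proper) = subst (_≤ α + α) (count-complement zero?)
    (+-mono-≤ (independent-count≤ zero? (λ x σu≡0 σv≡0 → proper x (trans σu≡0 (sym σv≡0))))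
              (independent-count≤ (∁? zero?) (λ x σu≢0 σv≢0 → proper x (≢-≢⇒≡ σu≢0 (σv≢0 ∘ sym)))))
    where
    zero? : Decidable (λ v → σ v ≡ 0ℙ)
    zero? v = σ v ≟ℙ 0ℙ

module FaceColors {G : RotationSystem} (plane : IsPlaneSimpleGraph G) {k : ℕ}
                  (col : Fin (RotationSystem.nV G) → Fin k) where

  open RotationSystem G
  open PlaneMap plane

  colorIs? : (j : Fin k) → Decidable (λ x → col (tail x) ≡ j)
  colorIs? j x = col (tail x) ≟ j

  colorOnFace? : (f : Fin nF) (j : Fin k) → Decidable (λ x → face x ≡ f × col (tail x) ≡ j)
  colorOnFace? f j = onFace? f ∩? colorIs? j

  colorCount≡count : ∀ f j → colorCountOnFace G col f j ≡ count (colorOnFace? f j)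
  colorCount≡count f j = length-filter-allFin (colorOnFace? f j)

  color-mate-on-face : ∀ {f j} → (∀ x y → face x ≡ face y → tail x ≡ tail y → x ≡ y) → 3 ≤ faceLength f →
    2 * colorCountOnFace G col f j ≡ faceLength f → ∀ {z} → face z ≡ f → col (tail z) ≡ j →
    ∃ λ w → col (tail w) ≡ j × tail w ≢ tail z
  color-mate-on-face {f} {j} distinct-tails long half {z} on-face color-z =
    let w , (on-face-w , color-w) , w≢z = count-satisfiable (colorOnFace? f j -? z) (at-least-two _ long-enough)
    in w , color-w , w≢z ∘ distinct-tails w z (trans on-face-w (sym on-face))
    where
    at-least-two : ∀ r → 3 ≤ 2 * suc r → 0 < r
    at-least-two zero    (s≤s (s≤s ()))
    at-least-two (suc r) _ = s≤s z≤n

    long-enough : 3 ≤ 2 * suc (count (colorOnFace? f j -? z))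
    long-enough = subst (λ m → 3 ≤ 2 * m) (count-remove (colorOnFace? f j) (on-face , color-z))
      (subst (3 ≤_) (trans (sym half) (cong (2 *_) (colorCount≡count f j))) long)

  half-color-meets-edge : ∀ {f j} → (∀ u v → Adj u v → col u ≢ col v) →
    2 * colorCountOnFace G col f j ≡ faceLength f →
    ∀ {x} → face x ≡ f → col (tail x) ≢ j → col (tail (φ x)) ≢ j → ⊥
  half-color-meets-edge {f} {j} proper half {x} on-face ¬j-x ¬j-φx = <-irrefl refl (begin-strict
    cJ + cJ                              <⟨ +-monoʳ-< cJ (s≤s φ-injects) ⟩
    cJ + suc (count (others? -? φ x))    ≡⟨ cong (cJ +_) (count-remove others? (on-face-φ , ¬j-φx)) ⟨
    cJ + count others?                   ≡⟨ count-split (onFace? f) (colorIs? j) ⟨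
    count (onFace? f)                    ≡⟨ faceLength≡count f ⟨
    faceLength f                         ≡⟨ trans (sym half) (cong (2 *_) (colorCount≡count f j)) ⟩
    2 * cJ                               ≡⟨ cong (cJ +_) (+-identityʳ cJ) ⟩
    cJ + cJ                              ∎)
    where
    open ≤-Reasoning
    cJ : ℕ
    cJ = count (colorOnFace? f j)

    others? : Decidable (λ y → face y ≡ f × col (tail y) ≢ j)
    others? = onFace? f ∩? ∁? (colorIs? j)

    on-face-φ : face (φ x) ≡ f
    on-face-φ = trans (face-φ x) on-face

    φ-injects : cJ ≤ count (others? -? φ x)
    φ-injects = count-≤-injection (colorOnFace? f j) (others? -? φ x) (λ {y} _ → φ y)
      (λ {y} (on-face-y , j-y) →
        (trans (face-φ y) on-face-y ,
         λ j-φy → proper (tail y) (tail (rev y)) (y , refl , refl)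
                    (trans j-y (sym (trans (cong col (sym (tail-φ y))) j-φy)))) ,
        λ φy≡φx → ¬j-x (subst (λ z → col (tail z) ≡ j) (φ-injective φy≡φx) j-y))
      (λ _ _ → φ-injective)

module LonelyVertices (P : PlaneGraphEvenFaces) {k : ℕ} (c : KColoring (PlaneGraphEvenFaces.graph P) k)
  (half-mono : HalfMonochromatic (PlaneGraphEvenFaces.graph P) c) where

  open PlaneGraphEvenFaces P
  open RotationSystem graph
  open PlaneMap plane
  open KColoring c
  open Fibres col onto
  open FaceColors plane col

  distinct-tails : ∀ x y → face x ≡ face y → tail x ≡ tail y → x ≡ y
  distinct-tails = proj₁ even

  long-faces : ∀ f → 3 ≤ faceLength f
  long-faces = proj₁ (proj₂ even)

  lonely-independent : ∀ x → Lonely (tail x) → ¬ Lonely (tail (rev x))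
  lonely-independent x lonely-u lonely-v with half-mono (face x)
  ... | j , half with col (tail x) ≟ j | col (tail (φ x)) ≟ j
  ... | yes j-u | _ =
    let w , j-w , w≢u = color-mate-on-face distinct-tails (long-faces (face x)) half refl j-u
    in w≢u (lonely-u (tail w) (trans j-w (sym j-u)))
  ... | no _ | yes j-φ =
    let w , j-w , w≢φ = color-mate-on-face distinct-tails (long-faces (face x)) half (face-φ x) j-φ
        j-v = trans (cong col (sym (tail-φ x))) j-φ
    in w≢φ (trans (lonely-v (tail w) (trans j-w (sym j-v))) (sym (tail-φ x)))
  ... | no ¬j-u | no ¬j-φ = half-color-meets-edge proper half refl ¬j-u ¬j-φ

theorem1p1 : (P : PlaneGraphEvenFaces) (χf α : ℕ) →
    IsChiF (PlaneGraphEvenFaces.graph P) χf →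
    IsIndependenceNumber (PlaneGraphEvenFaces.graph P) α →
    2 * χf ≤ 3 * α
theorem1p1 P χf α ((c , half-mono) , _) (_ , max-independent) = begin
  2 * χf                ≡⟨ cong (χf +_) (+-identityʳ χf) ⟩
  χf + χf               ≤⟨ twice-fibres≤points+lonely ⟩
  nV + count lonely?    ≤⟨ +-mono-≤ (two-colorable⇒≤2α (two-coloring plane (proj₂ (proj₂ even))))
                                    (independent-count≤ lonely? lonely-independent) ⟩
  α + α + α             ≡⟨ +-assoc α α α ⟩
  α + (α + α)           ≡⟨ cong (λ m → α + (α + m)) (+-identityʳ α) ⟨
  3 * α                 ∎
  where
  open ≤-Reasoning
  open PlaneGraphEvenFaces P
  open RotationSystem graph
  open KColoring c
  open Fibres col onto
  open Independence graph max-independent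
  open LonelyVertices P c half-mono
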